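{- For every integer $k\ge2$, $$\sum_{n\ge1}x^n\sum_{w\in\mathcal F_{n,k}}\deg_4(G(w))=\frac{3x^2+(1-k)x^k-(4-k)x^{k+1}-2x^{k+2}+2x^{2k+1}}{(1-2x+x^{k+1})^2}.$$
   Context: For integers $k\ge 2$, $n\ge1$, $\mathcal F_{n,k}$ is the set of binary words $w=w_1\cdots w_n$ with no $k$ consecutive $1$'s. $P(w)$ is the bargraph polyomino formed by the unit squares $[i-1,i]\times[j-1,j]$, $1\le i\le n$, $1\le j\le w_i+1$. $G(w)$ is the graph whose vertices are the corners of the cells of $P(w)$ and whose edges are the cell sides. $\deg_i(G)$ is the number of vertices of degree $i$ in $G$. -}

module Defs where

open import Data.Bool using (Bool; true; false; _∧_; _∨_; not; if_then_else_)
open import Data.Nat using (ℕ; zero; suc; _+_; _∸_; _≤ᵇ_; _≡ᵇ_)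
open import Data.List using (List; []; _∷_; map; concatMap; filter; length; take; drop; upTo)
open import Data.Bool.ListAction using (all; any)
open import Data.Nat.ListAction using (sum)
open import Data.Maybe using (Maybe; just; nothing)
open import Data.Integer as ℤ using (ℤ; +_)
open import Data.Bool.Properties using (T?)

-- Binary words (1 = true, 0 = false)

words : ℕ → List (List Bool)
words zero = [] ∷ []
words (suc n) = concatMap (λ w → (false ∷ w) ∷ (true ∷ w) ∷ []) (words n)

hasRun : ℕ → List Bool → Bool
hasRun k w = any (λ i → (k ≤ᵇ length (drop i w)) ∧ all (λ b → b) (take k (drop i w)))
                 (upTo (suc (length w)))

F : ℕ → ℕ → List (List Bool)
F n k = filter (λ w → T? (not (hasRun k w))) (words n)

letter : List Bool → ℕ → Maybe Bool
letter [] _ = nothing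
letter (b ∷ w) zero = just b
letter (b ∷ w) (suc i) = letter w i

val : Bool → ℕ
val true = 1
val false = 0

-- cell i j = unit square [i-1,i]×[j-1,j] belongs to P(w)
-- (1 ≤ i ≤ n, 1 ≤ j ≤ w_i + 1)
cell : List Bool → ℕ → ℕ → Bool
cell w zero j = false
cell w (suc i) j with letter w i
... | nothing = false
... | just b = (1 ≤ᵇ j) ∧ (j ≤ᵇ suc (val b))

-- horizontal unit segment [a,a+1]×{b} is a side of some cell
hEdge : List Bool → ℕ → ℕ → Bool
hEdge w a b = cell w (suc a) (suc b) ∨ cell w (suc a) b

-- vertical unit segment {a}×[b,b+1] is a side of some cell
vEdge : List Bool → ℕ → ℕ → Bool
vEdge w a b = cell w (suc a) (suc b) ∨ cell w a (suc b)

degree : List Bool → ℕ → ℕ → ℕ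
degree w a b = val (hEdge w a b) + left a + val (vEdge w a b) + down b
  where
  left : ℕ → ℕ
  left zero = 0
  left (suc a') = val (hEdge w a' b)
  down : ℕ → ℕ
  down zero = 0
  down (suc b') = val (vEdge w a b')

-- deg_4(G(w)): number of vertices of degree 4.  Every vertex of G(w) is a
-- lattice point (a,b) with 0 ≤ a ≤ n, 0 ≤ b ≤ 2 (heights are ≤ 2); we scan
-- 0 ≤ a ≤ n, 0 ≤ b ≤ 3 (points with no incident edge have degree 0 ≠ 4).
deg4 : List Bool → ℕ
deg4 w = sum (map (λ a → sum (map (λ b → if degree w a b ≡ᵇ 4 then 1 else 0) (upTo 4)))
                  (upTo (suc (length w))))

Series : Set
Series = ℕ → ℤ

sumTo : ℕ → (ℕ → ℤ) → ℤ
sumTo zero f = f 0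
sumTo (suc m) f = sumTo m f ℤ.+ f (suc m)

_⊛_ : Series → Series → Series
(f ⊛ g) m = sumTo m (λ i → f i ℤ.* g (m ∸ i))

_⊕_ : Series → Series → Series
(f ⊕ g) m = f m ℤ.+ g m

mono : ℤ → ℕ → Series
mono c e m = if m ≡ᵇ e then c else + 0

genDeg4 : ℕ → Series
genDeg4 k zero = + 0
genDeg4 k (suc n) = + sum (map deg4 (F (suc n) k))

numer : ℕ → Series
numer k = mono (+ 3) 2 ⊕ (mono (+ 1 ℤ.- + k) k ⊕ (mono (ℤ.- (+ 4 ℤ.- + k)) (suc k)
          ⊕ (mono (ℤ.- + 2) (k + 2) ⊕ mono (+ 2) (suc (k + k)))))

denom : ℕ → Series
denom k = mono (+ 1) 0 ⊕ (mono (ℤ.- + 2) 1 ⊕ mono (+ 1) (suc k))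

-- Split the words of 𝓕_{n,k} by their first letter. A vertex of degree 4 is a point
-- (a, 1) between two adjacent columns that are not both of height 1, so deg₄ (b ∷ w)
-- exceeds deg₄ w by the contribution of the first junction. The generating functions
-- of the words that may follow k − j ones (their number, and their total deg₄) thus
-- satisfy linear recurrences in j; telescoping them up to j = k gives
-- (1 − 2x + x^{k+1}) C = 1 − x^k for the counting series C and an expression for
-- (1 − 2x + x^{k+1}) A in terms of C for the deg₄ series A. Eliminating C is ring
-- arithmetic, valid in any commutative ring.
module Submission where

open import Defs
open import Data.Bool using (Bool; true; false; _∧_; _∨_; not; if_then_else_)
open import Data.Bool.Properties using (T?; ∨-assoc; ∨-idem; ∧-zeroʳ)
open import Data.Bool.ListAction using (all; any; or)
open import Data.List using (List; []; _∷_; map; filter; length; take; drop; upTo; concatMap)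
open import Data.List.Properties using (map-applyUpTo; map-cong)
open import Data.Maybe as Maybe using (Maybe; just; nothing)
open import Data.Nat as ℕ using (ℕ; zero; suc; _∸_; _≤_; _<_; _≤ᵇ_; _≡ᵇ_; z≤n; s≤s)
open import Data.Nat.ListAction using (sum)
import Data.Nat.Properties as ℕ
open import Data.Integer as ℤ using (ℤ; +_)
open import Data.Product using (_,_)
import Data.Integer.Properties as ℤ
open import Function using (_∘_; id)
open import Relation.Binary.PropositionalEquality using (_≡_; refl; sym; trans; cong; cong₂; _≗_; module ≡-Reasoning)
open import Level using (0ℓ)
open import Algebra.Bundles using (CommutativeRing)
open import Algebra.Structures using (IsCommutativeRing)
import Algebra.Construct.Pointwise as Pointwise
import Algebra.Properties.CommutativeSemigroup as CommutativeSemigroupProperties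
open import Algebra.Solver.Ring.AlmostCommutativeRing using (fromCommutativeRing; _-Raw-AlmostCommutative⟶_)
import Algebra.Solver.Ring
open import Relation.Nullary.Decidable.Core using (dec⇒maybe)

private variable A : Set

map-upTo-suc : ∀ (f : ℕ → A) n → map f (upTo (suc n)) ≡ f 0 ∷ map (f ∘ suc) (upTo n)
map-upTo-suc f n = cong (f 0 ∷_) (trans (map-applyUpTo suc f n) (sym (map-applyUpTo id (f ∘ suc) n)))

sum-map-+ : ∀ (φ ψ : A → ℕ) xs → sum (map (λ a → φ a ℕ.+ ψ a) xs) ≡ sum (map φ xs) ℕ.+ sum (map ψ xs)
sum-map-+ φ ψ []       = refl
sum-map-+ φ ψ (a ∷ xs) = trans (cong (φ a ℕ.+ ψ a ℕ.+_) (sum-map-+ φ ψ xs)) (interchange (φ a) (ψ a) _ _)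
  where open CommutativeSemigroupProperties ℕ.+-commutativeSemigroup using (interchange)

sum-map-zero : ∀ (xs : List A) → sum (map (λ _ → 0) xs) ≡ 0
sum-map-zero []       = refl
sum-map-zero (_ ∷ xs) = sum-map-zero xs

[_]×_ : Bool → ℕ → ℕ
[ b ]× n = if b then n else 0

[]×-zero : ∀ b → [ b ]× 0 ≡ 0
[]×-zero true  = refl
[]×-zero false = refl

[]×-+ : ∀ b m n → [ b ]× (m ℕ.+ n) ≡ [ b ]× m ℕ.+ [ b ]× n
[]×-+ true  m n = refl
[]×-+ false m n = refl

sum-map-filter : ∀ (p : A → Bool) (f : A → ℕ) xs →
                 sum (map f (filter (λ a → T? (p a)) xs)) ≡ sum (map (λ a → [ p a ]× f a) xs)
sum-map-filter p f []       = refl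
sum-map-filter p f (a ∷ xs) with p a
... | true  = cong (f a ℕ.+_) (sum-map-filter p f xs)
... | false = sum-map-filter p f xs

-- Degree-four vertices of a bargraph

columnDeg4 : List Bool → ℕ → ℕ
columnDeg4 w a = sum (map (λ b → if degree w a b ≡ᵇ 4 then 1 else 0) (upTo 4))

junction : Maybe Bool → Maybe Bool → ℕ
junction (just b) (just c) = val (b ∨ c)
junction _        _        = 0

columnDeg4-zero : ∀ w → columnDeg4 w 0 ≡ 0
columnDeg4-zero w with letter w 0
... | nothing    = refl
... | just false = refl
... | just true  = refl

-- On a line between two columns only the point at height 1 can have degree 4,
-- and it does exactly when one of the two columns has height 2.
columnDeg4-suc : ∀ w a → columnDeg4 w (suc a) ≡ junction (letter w a) (letter w (suc a))
columnDeg4-suc w a with letter w a | letter w (suc a)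
... | nothing    | nothing    = refl
... | nothing    | just false = refl
... | nothing    | just true  = refl
... | just false | nothing    = refl
... | just true  | nothing    = refl
... | just false | just false = refl
... | just false | just true  = refl
... | just true  | just false = refl
... | just true  | just true  = refl

junctions : List Bool → ℕ → ℕ
junctions w n = sum (map (λ a → junction (letter w a) (letter w (suc a))) (upTo n))

deg4≡junctions : ∀ w → deg4 w ≡ junctions w (length w)
deg4≡junctions w = begin
  sum (map (columnDeg4 w) (upTo (suc (length w))))
    ≡⟨ cong sum (map-upTo-suc (columnDeg4 w) (length w)) ⟩
  columnDeg4 w 0 ℕ.+ sum (map (columnDeg4 w ∘ suc) (upTo (length w)))
    ≡⟨ cong₂ ℕ._+_ (columnDeg4-zero w) (cong sum (map-cong (columnDeg4-suc w) (upTo (length w)))) ⟩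
  junctions w (length w)
    ∎
  where open ≡-Reasoning

link : Bool → List Bool → ℕ
link b []      = 0
link b (c ∷ _) = val (b ∨ c)

deg4-∷ : ∀ b w → deg4 (b ∷ w) ≡ link b w ℕ.+ deg4 w
deg4-∷ b w = begin
  deg4 (b ∷ w)
    ≡⟨ deg4≡junctions (b ∷ w) ⟩
  junctions (b ∷ w) (suc (length w))
    ≡⟨ cong sum (map-upTo-suc _ (length w)) ⟩
  junction (just b) (letter w 0) ℕ.+ junctions w (length w)
    ≡⟨ cong₂ ℕ._+_ (junction-head w) (sym (deg4≡junctions w)) ⟩
  link b w ℕ.+ deg4 w
    ∎
  where
  open ≡-Reasoning
  junction-head : ∀ w → junction (just b) (letter w 0) ≡ link b w
  junction-head []      = refl
  junction-head (_ ∷ _) = refl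

-- Runs of ones

startsWithOnes : ℕ → List Bool → Bool
startsWithOnes zero    w       = true
startsWithOnes (suc j) []      = false
startsWithOnes (suc j) (b ∷ w) = b ∧ startsWithOnes j w

window≡startsWithOnes : ∀ k v → (k ≤ᵇ length v) ∧ all (λ b → b) (take k v) ≡ startsWithOnes k v
window≡startsWithOnes zero          v           = refl
window≡startsWithOnes (suc k)       []          = refl
window≡startsWithOnes (suc zero)    (false ∷ w) = refl
window≡startsWithOnes (suc zero)    (true ∷ w)  = refl
window≡startsWithOnes (suc (suc k)) (false ∷ w) = ∧-zeroʳ _
window≡startsWithOnes (suc (suc k)) (true ∷ w)  = window≡startsWithOnes (suc k) w

hasRun-∷ : ∀ k b w → hasRun k (b ∷ w) ≡ startsWithOnes k (b ∷ w) ∨ hasRun k w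
hasRun-∷ k b w = begin
  hasRun k (b ∷ w)
    ≡⟨ cong or (map-upTo-suc window (suc (length w))) ⟩
  window 0 ∨ any (λ i → window (suc i)) (upTo (suc (length w)))
    ≡⟨ cong (_∨ hasRun k w) (window≡startsWithOnes k (b ∷ w)) ⟩
  startsWithOnes k (b ∷ w) ∨ hasRun k w
    ∎
  where
  open ≡-Reasoning
  window : ℕ → Bool
  window i = (k ≤ᵇ length (drop i (b ∷ w))) ∧ all (λ b → b) (take k (drop i (b ∷ w)))

startsWithOnes-∨-≤ : ∀ {j i} w → j ≤ i → startsWithOnes j w ∨ startsWithOnes i w ≡ startsWithOnes j w
startsWithOnes-∨-≤ w           z≤n       = refl
startsWithOnes-∨-≤ []          (s≤s j≤i) = refl
startsWithOnes-∨-≤ (false ∷ w) (s≤s j≤i) = refl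
startsWithOnes-∨-≤ (true ∷ w)  (s≤s j≤i) = startsWithOnes-∨-≤ w j≤i

startsWithOnes-∨-hasRun : ∀ k w → startsWithOnes k w ∨ hasRun k w ≡ hasRun k w
startsWithOnes-∨-hasRun zero    []      = refl
startsWithOnes-∨-hasRun (suc k) []      = refl
startsWithOnes-∨-hasRun k       (b ∷ w) = begin
  s ∨ hasRun k (b ∷ w)   ≡⟨ cong (s ∨_) (hasRun-∷ k b w) ⟩
  s ∨ (s ∨ hasRun k w)   ≡⟨ ∨-assoc s s _ ⟨
  (s ∨ s) ∨ hasRun k w   ≡⟨ cong (_∨ hasRun k w) (∨-idem s) ⟩
  s ∨ hasRun k w         ≡⟨ hasRun-∷ k b w ⟨
  hasRun k (b ∷ w)       ∎
  where
  open ≡-Reasoning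
  s = startsWithOnes k (b ∷ w)

Σwords : ℕ → (List Bool → ℕ) → ℕ
Σwords n φ = sum (map φ (words n))

Σwords-suc : ∀ n φ → Σwords (suc n) φ ≡ Σwords n (λ w → φ (false ∷ w) ℕ.+ φ (true ∷ w))
Σwords-suc n φ = go (words n)
  where
  go : ∀ ws → sum (map φ (concatMap (λ w → (false ∷ w) ∷ (true ∷ w) ∷ []) ws))
            ≡ sum (map (λ w → φ (false ∷ w) ℕ.+ φ (true ∷ w)) ws)
  go []       = refl
  go (w ∷ ws) = trans (cong (λ s → φ (false ∷ w) ℕ.+ (φ (true ∷ w) ℕ.+ s)) (go ws))
                      (sym (ℕ.+-assoc (φ (false ∷ w)) (φ (true ∷ w)) _))

module Counting (m : ℕ) where

  k : ℕ
  k = suc m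

  -- w can follow k ∸ j ones without creating a run of k ones
  admissible : ℕ → List Bool → Bool
  admissible j w = not (startsWithOnes j w ∨ hasRun k w)

  admissible-k : ∀ w → admissible k w ≡ not (hasRun k w)
  admissible-k w = cong not (startsWithOnes-∨-hasRun k w)

  admissible-false∷ : ∀ j w → admissible (suc j) (false ∷ w) ≡ admissible k w
  admissible-false∷ j w = begin
    not (false ∨ hasRun k (false ∷ w))   ≡⟨ cong not (hasRun-∷ k false w) ⟩
    not (hasRun k w)                     ≡⟨ admissible-k w ⟨
    admissible k w                       ∎
    where open ≡-Reasoning

  admissible-true∷ : ∀ {j} w → j < k → admissible (suc j) (true ∷ w) ≡ admissible j w
  admissible-true∷ {j} w (s≤s j≤m) = begin
    not (startsWithOnes j w ∨ hasRun k (true ∷ w))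
      ≡⟨ cong (λ r → not (startsWithOnes j w ∨ r)) (hasRun-∷ k true w) ⟩
    not (startsWithOnes j w ∨ (startsWithOnes m w ∨ hasRun k w))
      ≡⟨ cong not (∨-assoc (startsWithOnes j w) _ _) ⟨
    not ((startsWithOnes j w ∨ startsWithOnes m w) ∨ hasRun k w)
      ≡⟨ cong (λ s → not (s ∨ hasRun k w)) (startsWithOnes-∨-≤ w j≤m) ⟩
    not (startsWithOnes j w ∨ hasRun k w)
      ∎
    where open ≡-Reasoning

  Σadmissible : ℕ → (List Bool → ℕ) → ℕ → ℕ
  Σadmissible j φ n = Σwords n (λ w → [ admissible j w ]× φ w)

  Σadmissible-zero : ∀ φ n → Σadmissible 0 φ n ≡ 0
  Σadmissible-zero φ n = sum-map-zero (words n)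

  Σadmissible-suc : ∀ {j} φ n → j < k →
    Σadmissible (suc j) φ (suc n) ≡ Σadmissible k (φ ∘ (false ∷_)) n ℕ.+ Σadmissible j (φ ∘ (true ∷_)) n
  Σadmissible-suc {j} φ n j<k = begin
    Σadmissible (suc j) φ (suc n)
      ≡⟨ Σwords-suc n _ ⟩
    Σwords n (λ w → [ admissible (suc j) (false ∷ w) ]× φ (false ∷ w)
                ℕ.+ [ admissible (suc j) (true ∷ w) ]× φ (true ∷ w))
      ≡⟨ cong sum (map-cong (λ w → cong₂ (λ s t → [ s ]× φ (false ∷ w) ℕ.+ [ t ]× φ (true ∷ w))
                                          (admissible-false∷ j w) (admissible-true∷ w j<k)) (words n)) ⟩
    Σwords n (λ w → [ admissible k w ]× φ (false ∷ w) ℕ.+ [ admissible j w ]× φ (true ∷ w))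
      ≡⟨ sum-map-+ _ _ (words n) ⟩
    Σadmissible k (φ ∘ (false ∷_)) n ℕ.+ Σadmissible j (φ ∘ (true ∷_)) n
      ∎
    where open ≡-Reasoning

  count degreeSum : ℕ → ℕ → ℕ
  count j = Σadmissible j (λ _ → 1)
  degreeSum j = Σadmissible j deg4

  headOnes : ℕ → ℕ
  headOnes = Σadmissible k (link false)

  nonemptyCount : ℕ → ℕ → ℕ
  nonemptyCount j = Σadmissible j (link true)

  degreeSum-suc : ∀ {j} n → j < k →
    degreeSum (suc j) (suc n) ≡ (degreeSum k n ℕ.+ headOnes n) ℕ.+ (degreeSum j n ℕ.+ nonemptyCount j n)
  degreeSum-suc {j} n j<k = begin
    degreeSum (suc j) (suc n)
      ≡⟨ Σadmissible-suc deg4 n j<k ⟩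
    Σadmissible k (deg4 ∘ (false ∷_)) n ℕ.+ Σadmissible j (deg4 ∘ (true ∷_)) n
      ≡⟨ cong₂ ℕ._+_ (split k false) (split j true) ⟩
    (degreeSum k n ℕ.+ headOnes n) ℕ.+ (degreeSum j n ℕ.+ nonemptyCount j n)
      ∎
    where
    open ≡-Reasoning
    split : ∀ i b → Σadmissible i (deg4 ∘ (b ∷_)) n ≡ degreeSum i n ℕ.+ Σadmissible i (link b) n
    split i b = begin
      Σwords n (λ w → [ admissible i w ]× deg4 (b ∷ w))
        ≡⟨ cong sum (map-cong bracket-split (words n)) ⟩
      Σwords n (λ w → [ admissible i w ]× deg4 w ℕ.+ [ admissible i w ]× link b w)
        ≡⟨ sum-map-+ _ _ (words n) ⟩
      degreeSum i n ℕ.+ Σadmissible i (link b) n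
        ∎
      where
      bracket-split : ∀ w → [ admissible i w ]× deg4 (b ∷ w)
                          ≡ [ admissible i w ]× deg4 w ℕ.+ [ admissible i w ]× link b w
      bracket-split w = trans (cong ([ admissible i w ]×_) (trans (deg4-∷ b w) (ℕ.+-comm (link b w) (deg4 w))))
                              ([]×-+ (admissible i w) (deg4 w) (link b w))

  headOnes-suc : ∀ n → headOnes (suc n) ≡ count m n
  headOnes-suc n = begin
    headOnes (suc n)
      ≡⟨ Σadmissible-suc (link false) n ℕ.≤-refl ⟩
    Σadmissible k (λ _ → 0) n ℕ.+ count m n
      ≡⟨ cong (ℕ._+ count m n) (cong sum (map-cong (λ w → []×-zero (admissible k w)) (words n))) ⟩
    sum (map (λ _ → 0) (words n)) ℕ.+ count m n
      ≡⟨ cong (ℕ._+ count m n) (sum-map-zero (words n)) ⟩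
    count m n
      ∎
    where open ≡-Reasoning

  nonemptyCount-suc : ∀ {j} n → j < k → nonemptyCount (suc j) (suc n) ≡ count (suc j) (suc n)
  nonemptyCount-suc n j<k = trans (Σadmissible-suc (link true) n j<k) (sym (Σadmissible-suc (λ _ → 1) n j<k))

  sum-deg4-F : ∀ n → sum (map deg4 (F n k)) ≡ degreeSum k n
  sum-deg4-F n = trans (sum-map-filter (λ w → not (hasRun k w)) deg4 (words n))
                       (cong sum (map-cong (λ w → cong (λ b → [ b ]× deg4 w) (sym (admissible-k w))) (words n)))

-- The ring of formal power series

module PowerSeries where
  open import Data.Integer using (_+_; _*_; -_)

  𝟘 : Series
  𝟘 _ = + 0

  ⊖_ : Series → Series
  (⊖ f) m = - f m

  const : ℤ → Series
  const c = mono c 0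

  _⊙_ : ℤ → Series → Series
  (c ⊙ f) m = c * f m

  tail : Series → Series
  tail f n = f (suc n)

  sumTo-cong : ∀ m {h h′} → (∀ i → i ≤ m → h i ≡ h′ i) → sumTo m h ≡ sumTo m h′
  sumTo-cong zero    eq = eq 0 z≤n
  sumTo-cong (suc m) eq = cong₂ _+_ (sumTo-cong m λ i i≤m → eq i (ℕ.m≤n⇒m≤1+n i≤m))
                                    (eq (suc m) ℕ.≤-refl)

  sumTo-+ : ∀ m h h′ → sumTo m (λ i → h i + h′ i) ≡ sumTo m h + sumTo m h′
  sumTo-+ zero    h h′ = refl
  sumTo-+ (suc m) h h′ = trans (cong (_+ (h (suc m) + h′ (suc m))) (sumTo-+ m h h′))
                               (interchange (sumTo m h) (sumTo m h′) (h (suc m)) (h′ (suc m)))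
    where open CommutativeSemigroupProperties ℤ.+-commutativeSemigroup using (interchange)

  sumTo-*ˡ : ∀ m c h → sumTo m (λ i → c * h i) ≡ c * sumTo m h
  sumTo-*ˡ zero    c h = refl
  sumTo-*ˡ (suc m) c h = trans (cong (_+ c * h (suc m)) (sumTo-*ˡ m c h))
                               (sym (ℤ.*-distribˡ-+ c (sumTo m h) (h (suc m))))

  sumTo-zero : ∀ m → sumTo m (λ _ → + 0) ≡ + 0
  sumTo-zero zero    = refl
  sumTo-zero (suc m) = cong (_+ + 0) (sumTo-zero m)

  sumTo-head : ∀ m h → sumTo (suc m) h ≡ h 0 + sumTo m (h ∘ suc)
  sumTo-head zero    h = refl
  sumTo-head (suc m) h = trans (cong (_+ h (suc (suc m))) (sumTo-head m h)) (ℤ.+-assoc (h 0) _ _)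

  sumTo-reverse : ∀ m h → sumTo m (λ i → h (m ∸ i)) ≡ sumTo m h
  sumTo-reverse zero    h = refl
  sumTo-reverse (suc m) h = begin
    sumTo (suc m) (λ i → h (suc m ∸ i))       ≡⟨ sumTo-head m _ ⟩
    h (suc m) + sumTo m (λ i → h (m ∸ i))     ≡⟨ cong (_+_ (h (suc m))) (sumTo-reverse m h) ⟩
    h (suc m) + sumTo m h                     ≡⟨ ℤ.+-comm (h (suc m)) (sumTo m h) ⟩
    sumTo (suc m) h                           ∎
    where open ≡-Reasoning

  ⊛-congˡ : ∀ {f f′} g → f ≗ f′ → f ⊛ g ≗ f′ ⊛ g
  ⊛-congˡ g eq m = sumTo-cong m λ i _ → cong (_* g (m ∸ i)) (eq i)

  ⊛-comm : ∀ f g → f ⊛ g ≗ g ⊛ f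
  ⊛-comm f g m = begin
    sumTo m (λ i → f i * g (m ∸ i))               ≡⟨ sumTo-reverse m _ ⟨
    sumTo m (λ i → f (m ∸ i) * g (m ∸ (m ∸ i)))   ≡⟨ sumTo-cong m swap ⟩
    sumTo m (λ i → g i * f (m ∸ i))               ∎
    where
    open ≡-Reasoning
    swap : ∀ i → i ≤ m → f (m ∸ i) * g (m ∸ (m ∸ i)) ≡ g i * f (m ∸ i)
    swap i i≤m = trans (cong (λ j → f (m ∸ i) * g j) (ℕ.m∸[m∸n]≡n i≤m)) (ℤ.*-comm (f (m ∸ i)) (g i))

  ⊛-cong : ∀ {f f′ g g′} → f ≗ f′ → g ≗ g′ → f ⊛ g ≗ f′ ⊛ g′
  ⊛-cong {f} {f′} {g} {g′} f≗f′ g≗g′ m = begin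
    (f ⊛ g) m    ≡⟨ ⊛-congˡ g f≗f′ m ⟩
    (f′ ⊛ g) m   ≡⟨ ⊛-comm f′ g m ⟩
    (g ⊛ f′) m   ≡⟨ ⊛-congˡ f′ g≗g′ m ⟩
    (g′ ⊛ f′) m  ≡⟨ ⊛-comm g′ f′ m ⟩
    (f′ ⊛ g′) m  ∎
    where open ≡-Reasoning

  ⊛-distribʳ : ∀ h f g → (f ⊕ g) ⊛ h ≗ (f ⊛ h) ⊕ (g ⊛ h)
  ⊛-distribʳ h f g m = trans (sumTo-cong m λ i _ → ℤ.*-distribʳ-+ (h (m ∸ i)) (f i) (g i)) (sumTo-+ m _ _)

  ⊛-distribˡ : ∀ h f g → h ⊛ (f ⊕ g) ≗ (h ⊛ f) ⊕ (h ⊛ g)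
  ⊛-distribˡ h f g m = trans (⊛-comm h (f ⊕ g) m)
                             (trans (⊛-distribʳ h f g m) (cong₂ _+_ (⊛-comm f h m) (⊛-comm g h m)))

  ⊙-⊛ : ∀ c f g → (c ⊙ f) ⊛ g ≗ c ⊙ (f ⊛ g)
  ⊙-⊛ c f g m = trans (sumTo-cong m λ i _ → ℤ.*-assoc c (f i) (g (m ∸ i))) (sumTo-*ˡ m c _)

  ⊛-suc : ∀ f g m → (f ⊛ g) (suc m) ≡ f 0 * g (suc m) + (tail f ⊛ g) m
  ⊛-suc f g m = sumTo-head m _

  ⊛-assoc : ∀ f g h → (f ⊛ g) ⊛ h ≗ f ⊛ (g ⊛ h)
  ⊛-assoc f g h zero    = ℤ.*-assoc (f 0) (g 0) (h 0)
  ⊛-assoc f g h (suc m) = begin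
    ((f ⊛ g) ⊛ h) (suc m)
      ≡⟨ ⊛-suc (f ⊛ g) h m ⟩
    f₀g₀ * h (suc m) + (tail (f ⊛ g) ⊛ h) m
      ≡⟨ cong (_+_ (f₀g₀ * h (suc m))) (⊛-congˡ h (⊛-suc f g) m) ⟩
    f₀g₀ * h (suc m) + (((f 0 ⊙ tail g) ⊕ (tail f ⊛ g)) ⊛ h) m
      ≡⟨ cong (_+_ (f₀g₀ * h (suc m))) (⊛-distribʳ h (f 0 ⊙ tail g) (tail f ⊛ g) m) ⟩
    f₀g₀ * h (suc m) + (((f 0 ⊙ tail g) ⊛ h) m + ((tail f ⊛ g) ⊛ h) m)
      ≡⟨ cong₂ (λ s t → f₀g₀ * h (suc m) + (s + t)) (⊙-⊛ (f 0) (tail g) h m) (⊛-assoc (tail f) g h m) ⟩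
    f₀g₀ * h (suc m) + (f 0 * (tail g ⊛ h) m + (tail f ⊛ (g ⊛ h)) m)
      ≡⟨ regroup (f 0) (g 0) (h (suc m)) ((tail g ⊛ h) m) ((tail f ⊛ (g ⊛ h)) m) ⟩
    f 0 * (g 0 * h (suc m) + (tail g ⊛ h) m) + (tail f ⊛ (g ⊛ h)) m
      ≡⟨ cong (λ s → f 0 * s + (tail f ⊛ (g ⊛ h)) m) (⊛-suc g h m) ⟨
    f 0 * (g ⊛ h) (suc m) + (tail f ⊛ (g ⊛ h)) m
      ≡⟨ ⊛-suc f (g ⊛ h) m ⟨
    (f ⊛ (g ⊛ h)) (suc m)
      ∎
    where
    open ≡-Reasoning
    f₀g₀ = f 0 * g 0
    regroup : ∀ a b c d e → a * b * c + (a * d + e) ≡ a * (b * c + d) + e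
    regroup a b c d e = begin
      a * b * c + (a * d + e)     ≡⟨ ℤ.+-assoc (a * b * c) (a * d) e ⟨
      a * b * c + a * d + e       ≡⟨ cong (λ s → s + a * d + e) (ℤ.*-assoc a b c) ⟩
      a * (b * c) + a * d + e     ≡⟨ cong (_+ e) (ℤ.*-distribˡ-+ a (b * c) d) ⟨
      a * (b * c + d) + e         ∎

  const-⊛ : ∀ c f → const c ⊛ f ≗ c ⊙ f
  const-⊛ c f zero    = refl
  const-⊛ c f (suc m) = begin
    (const c ⊛ f) (suc m)                  ≡⟨ ⊛-suc (const c) f m ⟩
    c * f (suc m) + (tail (const c) ⊛ f) m ≡⟨ cong (_+_ (c * f (suc m))) (𝟘-⊛ m) ⟩
    c * f (suc m) + + 0                    ≡⟨ ℤ.+-identityʳ _ ⟩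
    c * f (suc m)                          ∎
    where
    open ≡-Reasoning
    𝟘-⊛ : tail (const c) ⊛ f ≗ 𝟘
    𝟘-⊛ m = trans (sumTo-cong m λ i _ → ℤ.*-zeroˡ (f (m ∸ i))) (sumTo-zero m)

  ⊛-identityˡ : ∀ f → const (+ 1) ⊛ f ≗ f
  ⊛-identityˡ f m = trans (const-⊛ (+ 1) f m) (ℤ.*-identityˡ (f m))

  ⊛-identityʳ : ∀ f → f ⊛ const (+ 1) ≗ f
  ⊛-identityʳ f m = trans (⊛-comm f (const (+ 1)) m) (⊛-identityˡ f m)

  isCommutativeRing : IsCommutativeRing _≗_ _⊕_ _⊛_ ⊖_ 𝟘 (const (+ 1))
  isCommutativeRing = record
    { isRing = record
      { +-isAbelianGroup = Pointwise.isAbelianGroup ℕ ℤ.+-0-isAbelianGroup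
      ; *-cong           = ⊛-cong
      ; *-assoc          = ⊛-assoc
      ; *-identity       = ⊛-identityˡ , ⊛-identityʳ
      ; distrib          = ⊛-distribˡ , ⊛-distribʳ
      }
    ; *-comm = ⊛-comm
    }

  ring : CommutativeRing 0ℓ 0ℓ
  ring = record { isCommutativeRing = isCommutativeRing }

  constMorphism : CommutativeRing.rawRing ℤ.+-*-commutativeRing -Raw-AlmostCommutative⟶ fromCommutativeRing ring
  constMorphism = record
    { ⟦_⟧    = const
    ; +-homo = λ { a b zero → refl ; a b (suc m) → refl }
    ; *-homo = λ { a b zero → refl ; a b (suc m) → sym (trans (const-⊛ a (const b) (suc m)) (ℤ.*-zeroʳ a)) }
    ; -‿homo = λ { a zero → refl ; a (suc m) → refl }
    ; 0-homo = λ { zero → refl ; (suc m) → refl }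
    ; 1-homo = λ _ → refl
    }

  open import Algebra.Properties.Semiring.Exp (CommutativeRing.semiring ring) using (_^_)

  X : Series
  X = mono (+ 1) 1

  X⊛-suc : ∀ s n → (X ⊛ s) (suc n) ≡ s n
  X⊛-suc s n = begin
    (X ⊛ s) (suc n)                          ≡⟨ ⊛-suc X s n ⟩
    + 0 * s (suc n) + (const (+ 1) ⊛ s) n     ≡⟨ cong₂ _+_ (ℤ.*-zeroˡ (s (suc n))) (⊛-identityˡ s n) ⟩
    + 0 + s n                                 ≡⟨ ℤ.+-identityˡ (s n) ⟩
    s n                                       ∎
    where open ≡-Reasoning

  ≗X⊛ : ∀ {s} t → s 0 ≡ + 0 → (∀ n → s (suc n) ≡ t n) → s ≗ X ⊛ t
  ≗X⊛ t s₀ sₙ zero    = trans s₀ (sym (ℤ.*-zeroˡ (t 0)))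
  ≗X⊛ t s₀ sₙ (suc n) = trans (sₙ n) (sym (X⊛-suc t n))

  ≗const⊕X⊛ : ∀ {s} c t → s 0 ≡ c → (∀ n → s (suc n) ≡ t n) → s ≗ const c ⊕ (X ⊛ t)
  ≗const⊕X⊛ c t s₀ sₙ zero    = trans s₀ (sym (trans (cong (_+_ c) (ℤ.*-zeroˡ (t 0))) (ℤ.+-identityʳ c)))
  ≗const⊕X⊛ c t s₀ sₙ (suc n) = trans (sₙ n)
                                      (sym (trans (cong (_+_ (+ 0)) (X⊛-suc t n)) (ℤ.+-identityˡ (t n))))

  X^≗mono : ∀ e → X ^ e ≗ mono (+ 1) e
  X^≗mono zero    m = refl
  X^≗mono (suc e) m = trans (⊛-cong {X} {X} (λ _ → refl) (X^≗mono e) m)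
                            (sym (≗X⊛ {mono (+ 1) (suc e)} (mono (+ 1) e) refl (λ _ → refl) m))

  mono≗ : ∀ c e → mono c e ≗ const c ⊛ (X ^ e)
  mono≗ c e m = begin
    mono c e m             ≡⟨ scale ⟩
    c * mono (+ 1) e m     ≡⟨ cong (c *_) (X^≗mono e m) ⟨
    c * (X ^ e) m          ≡⟨ const-⊛ c (X ^ e) m ⟨
    (const c ⊛ (X ^ e)) m    ∎
    where
    open ≡-Reasoning
    scale : mono c e m ≡ c * mono (+ 1) e m
    scale with m ≡ᵇ e
    ... | true  = sym (ℤ.*-identityʳ c)
    ... | false = sym (ℤ.*-zeroʳ c)

-- Solving the recurrences in an arbitrary commutative ring

-- ι is the canonical map ℤ → R: the ring solver needs coefficients with decidable equality.
module Recurrences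
  (R : CommutativeRing 0ℓ 0ℓ)
  (ι : CommutativeRing.rawRing ℤ.+-*-commutativeRing -Raw-AlmostCommutative⟶ fromCommutativeRing R)
  where

  open CommutativeRing R hiding (refl; sym; trans)
  open CommutativeRing R using () renaming (refl to ≈-refl; trans to ≈-trans)
  open _-Raw-AlmostCommutative⟶_ ι using (⟦_⟧; +-homo; -‿homo)
  open import Algebra.Properties.Semiring.Exp semiring using (_^_; ^-homo-*)
  open import Relation.Binary.Reasoning.Setoid setoid

  coefficient≟ : ∀ i j → Maybe (⟦ i ⟧ ≈ ⟦ j ⟧)
  coefficient≟ i j = Maybe.map (λ { refl → ≈-refl }) (dec⇒maybe (i ℤ.≟ j))

  open Algebra.Solver.Ring (CommutativeRing.rawRing ℤ.+-*-commutativeRing) (fromCommutativeRing R) ι coefficient≟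
    using (solve; _:+_; _:*_; _:-_; :-_; _:^_; con; _:=_)

  𝟏 : Carrier
  𝟏 = ⟦ + 1 ⟧

  -- c j, a j and H stand for the generating functions of count j, degreeSum j and headOnes
  -- for k = q + 2; the hypotheses are their first-letter recurrences.
  module Solution
    (q : ℕ) (x H : Carrier) (c a : ℕ → Carrier)
    (c-one : c 1 ≈ 𝟏 + x * c (suc (suc q)))
    (c-suc : ∀ j → suc j < suc (suc q) → c (suc (suc j)) ≈ 𝟏 + x * (c (suc (suc q)) + c (suc j)))
    (a-one : a 1 ≈ x * (a (suc (suc q)) + H))
    (a-suc : ∀ j → suc j < suc (suc q) →
             a (suc (suc j)) ≈ x * (a (suc (suc q)) + H + a (suc j) + (c (suc j) - 𝟏)))
    (H≈ : H ≈ x * c (suc q))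
    where

    k : ℕ
    k = suc (suc q)

    Cₖ Aₖ B G : Carrier
    Cₖ = c k
    Aₖ = a k
    B = Aₖ + H
    G = 𝟏 + x * Cₖ

    count-difference : ∀ j → suc j < k → c (suc (suc j)) - c (suc j) ≈ x ^ suc j * G
    count-difference zero j<k = begin
      c 2 - c 1
        ≈⟨ +-cong (c-suc 0 j<k) (-‿cong c-one) ⟩
      𝟏 + x * (Cₖ + c 1) - (𝟏 + x * Cₖ)
        ≈⟨ solve 3 (λ x Cₖ u → con (+ 1) :+ x :* (Cₖ :+ u) :- (con (+ 1) :+ x :* Cₖ) := x :* u)
                   ≈-refl x Cₖ (c 1) ⟩
      x * c 1
        ≈⟨ *-congˡ c-one ⟩
      x * G
        ≈⟨ solve 2 (λ x G → x :* G := x :^ 1 :* G) ≈-refl x G ⟩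
      x ^ 1 * G
        ∎
    count-difference (suc j) j<k = begin
      c (suc (suc (suc j))) - c (suc (suc j))
        ≈⟨ +-cong (c-suc (suc j) j<k) (-‿cong (c-suc j j<k′)) ⟩
      𝟏 + x * (Cₖ + c (suc (suc j))) - (𝟏 + x * (Cₖ + c (suc j)))
        ≈⟨ solve 4 (λ x Cₖ u v → con (+ 1) :+ x :* (Cₖ :+ u) :- (con (+ 1) :+ x :* (Cₖ :+ v))
                               := x :* (u :- v))
                   ≈-refl x Cₖ (c (suc (suc j))) (c (suc j)) ⟩
      x * (c (suc (suc j)) - c (suc j))
        ≈⟨ *-congˡ (count-difference j j<k′) ⟩
      x * (x ^ suc j * G)
        ≈⟨ *-assoc x (x ^ suc j) G ⟨
      x ^ suc (suc j) * G
        ∎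
      where j<k′ = ℕ.<-trans (ℕ.n<1+n (suc j)) j<k

    degree-difference : ∀ j → suc j < k →
      a (suc (suc j)) - a (suc j) ≈ x ^ suc j * (x * (B + Cₖ) + ⟦ + j ⟧ * G)
    degree-difference zero j<k = begin
      a 2 - a 1
        ≈⟨ +-cong (a-suc 0 j<k) (-‿cong a-one) ⟩
      x * (B + a 1 + (c 1 - 𝟏)) - x * B
        ≈⟨ +-congʳ (*-congˡ (+-cong (+-congˡ a-one) (+-congʳ c-one))) ⟩
      x * (B + x * B + (𝟏 + x * Cₖ - 𝟏)) - x * B
        ≈⟨ solve 4 (λ x B Cₖ G → x :* (B :+ x :* B :+ (con (+ 1) :+ x :* Cₖ :- con (+ 1))) :- x :* B
                               := x :^ 1 :* (x :* (B :+ Cₖ) :+ con (+ 0) :* G))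
                   ≈-refl x B Cₖ G ⟩
      x ^ 1 * (x * (B + Cₖ) + ⟦ + 0 ⟧ * G)
        ∎
    degree-difference (suc j) j<k = begin
      a (suc (suc (suc j))) - a (suc (suc j))
        ≈⟨ +-cong (a-suc (suc j) j<k) (-‿cong (a-suc j j<k′)) ⟩
      x * (B + a (suc (suc j)) + (c (suc (suc j)) - 𝟏)) - x * (B + a (suc j) + (c (suc j) - 𝟏))
        ≈⟨ solve 6 (λ x B u v s t → x :* (B :+ u :+ (s :- con (+ 1))) :- x :* (B :+ v :+ (t :- con (+ 1)))
                                  := x :* (u :- v) :+ x :* (s :- t))
                   ≈-refl x B (a (suc (suc j))) (a (suc j)) (c (suc (suc j))) (c (suc j)) ⟩
      x * (a (suc (suc j)) - a (suc j)) + x * (c (suc (suc j)) - c (suc j))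
        ≈⟨ +-cong (*-congˡ (degree-difference j j<k′)) (*-congˡ (count-difference j j<k′)) ⟩
      x * (x ^ suc j * (x * (B + Cₖ) + ⟦ + j ⟧ * G)) + x * (x ^ suc j * G)
        ≈⟨ solve 6 (λ x X B Cₖ J G → x :* (X :* (x :* (B :+ Cₖ) :+ J :* G)) :+ x :* (X :* G)
                                   := x :* X :* (x :* (B :+ Cₖ) :+ (con (+ 1) :+ J) :* G))
                   ≈-refl x (x ^ suc j) B Cₖ ⟦ + j ⟧ G ⟩
      x ^ suc (suc j) * (x * (B + Cₖ) + (𝟏 + ⟦ + j ⟧) * G)
        ≈⟨ *-congˡ (+-congˡ (*-congʳ (+-homo (+ 1) (+ j)))) ⟨
      x ^ suc (suc j) * (x * (B + Cₖ) + ⟦ + suc j ⟧ * G)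
        ∎
      where j<k′ = ℕ.<-trans (ℕ.n<1+n (suc j)) j<k

    z y κ d : Carrier
    z = x ^ suc q
    y = x ^ k
    κ = ⟦ + 2 ⟧ + ⟦ + q ⟧
    d = 𝟏 - ⟦ + 2 ⟧ * x + x * y

    c-penultimate : c (suc q) ≈ Cₖ - z * G
    c-penultimate = begin
      c (suc q)              ≈⟨ solve 2 (λ Cₖ u → u := Cₖ :- (Cₖ :- u)) ≈-refl Cₖ (c (suc q)) ⟩
      Cₖ - (Cₖ - c (suc q))  ≈⟨ +-congˡ (-‿cong (count-difference q ℕ.≤-refl)) ⟩
      Cₖ - z * G             ∎

    a-penultimate : a (suc q) ≈ Aₖ - z * (x * (B + Cₖ) + ⟦ + q ⟧ * G)
    a-penultimate = begin
      a (suc q)                               ≈⟨ solve 2 (λ Aₖ u → u := Aₖ :- (Aₖ :- u)) ≈-refl Aₖ (a (suc q)) ⟩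
      Aₖ - (Aₖ - a (suc q))                   ≈⟨ +-congˡ (-‿cong (degree-difference q ℕ.≤-refl)) ⟩
      Aₖ - z * (x * (B + Cₖ) + ⟦ + q ⟧ * G)   ∎

    countGF : d * Cₖ ≈ 𝟏 - y
    countGF = begin
      d * Cₖ
        ≈⟨ solve 3 (λ x z Cₖ → (con (+ 1) :- con (+ 2) :* x :+ x :* (x :* z)) :* Cₖ
                             := Cₖ :- (x :* Cₖ :+ x :* (Cₖ :- z :* (con (+ 1) :+ x :* Cₖ))) :- x :* z)
                   ≈-refl x z Cₖ ⟩
      Cₖ - (x * Cₖ + x * (Cₖ - z * G)) - y
        ≈⟨ +-congʳ (+-congʳ (≈-trans (c-suc q ℕ.≤-refl) (+-congˡ (*-congˡ (+-congˡ c-penultimate))))) ⟩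
      𝟏 + x * (Cₖ + (Cₖ - z * G)) - (x * Cₖ + x * (Cₖ - z * G)) - y
        ≈⟨ solve 4 (λ x z Cₖ G → con (+ 1) :+ x :* (Cₖ :+ (Cₖ :- z :* G)) :- (x :* Cₖ :+ x :* (Cₖ :- z :* G)) :- x :* z
                               := con (+ 1) :- x :* z)
                   ≈-refl x z Cₖ G ⟩
      𝟏 - y
        ∎

    headGF : H ≈ x * Cₖ - y * G
    headGF = begin
      H                 ≈⟨ H≈ ⟩
      x * c (suc q)     ≈⟨ *-congˡ c-penultimate ⟩
      x * (Cₖ - z * G)  ≈⟨ solve 4 (λ x z Cₖ G → x :* (Cₖ :- z :* G) := x :* Cₖ :- x :* z :* G) ≈-refl x z Cₖ G ⟩
      x * Cₖ - y * G    ∎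

    degGF : d * Aₖ ≈ x * (𝟏 - y) * H + x * (𝟏 - κ * y) * Cₖ - x + (𝟏 - κ) * y
    degGF = begin
      d * Aₖ
        ≈⟨ solve 3 (λ x z Aₖ → (con (+ 1) :- con (+ 2) :* x :+ x :* (x :* z)) :* Aₖ
                             := Aₖ :+ (x :* (x :* z) :- con (+ 2) :* x) :* Aₖ)
                   ≈-refl x z Aₖ ⟩
      Aₖ + (x * y - ⟦ + 2 ⟧ * x) * Aₖ
        ≈⟨ +-congʳ (≈-trans (a-suc q ℕ.≤-refl)
                            (*-congˡ (+-cong (+-congˡ a-penultimate) (+-congʳ c-penultimate)))) ⟩
      x * (B + (Aₖ - z * (x * (B + Cₖ) + ⟦ + q ⟧ * G)) + (Cₖ - z * G - 𝟏)) + (x * y - ⟦ + 2 ⟧ * x) * Aₖ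
        ≈⟨ solve 6 (λ x z Aₖ H Cₖ Q →
             x :* ((Aₖ :+ H) :+ (Aₖ :- z :* (x :* ((Aₖ :+ H) :+ Cₖ) :+ Q :* (con (+ 1) :+ x :* Cₖ)))
                  :+ (Cₖ :- z :* (con (+ 1) :+ x :* Cₖ) :- con (+ 1)))
               :+ (x :* (x :* z) :- con (+ 2) :* x) :* Aₖ
             := x :* (con (+ 1) :- x :* z) :* H :+ x :* (con (+ 1) :- (con (+ 2) :+ Q) :* (x :* z)) :* Cₖ :- x
                  :+ (con (+ 1) :- (con (+ 2) :+ Q)) :* (x :* z))
           ≈-refl x z Aₖ H Cₖ ⟦ + q ⟧ ⟩
      x * (𝟏 - y) * H + x * (𝟏 - κ * y) * Cₖ - x + (𝟏 - κ) * y
        ∎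

    denominator numerator : Carrier
    denominator = ⟦ + 1 ⟧ * x ^ 0 + (⟦ ℤ.- + 2 ⟧ * x ^ 1 + ⟦ + 1 ⟧ * x ^ suc k)
    numerator   = ⟦ + 3 ⟧ * x ^ 2 + (⟦ + 1 ℤ.- + k ⟧ * x ^ k + (⟦ ℤ.- (+ 4 ℤ.- + k) ⟧ * x ^ suc k
                  + (⟦ ℤ.- + 2 ⟧ * x ^ (k ℕ.+ 2) + ⟦ + 2 ⟧ * x ^ suc (k ℕ.+ k))))

    denominator≈d : denominator ≈ d
    denominator≈d = solve 2 (λ x y → con (+ 1) :* x :^ 0 :+ (con (ℤ.- + 2) :* x :^ 1 :+ con (+ 1) :* (x :* y))
                                   := con (+ 1) :- con (+ 2) :* x :+ x :* y)
                            ≈-refl x y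

    ⟦-k⟧ : ∀ i → ⟦ i ℤ.- + k ⟧ ≈ ⟦ i ⟧ - κ
    ⟦-k⟧ i = ≈-trans (+-homo i (ℤ.- + k)) (+-congˡ (≈-trans (-‿homo (+ k)) (-‿cong (+-homo (+ 2) (+ q)))))

    numerator≈ : numerator ≈ ⟦ + 3 ⟧ * x ^ 2 + ((𝟏 - κ) * y + (- (⟦ + 4 ⟧ - κ) * (x * y)
                             + (⟦ ℤ.- + 2 ⟧ * (y * x ^ 2) + ⟦ + 2 ⟧ * (x * (y * y)))))
    numerator≈ = +-congˡ (+-cong (*-congʳ (⟦-k⟧ (+ 1)))
                         (+-cong (*-congʳ (≈-trans (-‿homo (+ 4 ℤ.- + k)) (-‿cong (⟦-k⟧ (+ 4)))))
                         (+-cong (*-congˡ (^-homo-* x k 2)) (*-congˡ (*-congˡ (^-homo-* x k k))))))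

    generatingFunction : denominator * denominator * Aₖ ≈ numerator
    generatingFunction = begin
      denominator * denominator * Aₖ
        ≈⟨ *-congʳ (*-cong denominator≈d denominator≈d) ⟩
      d * d * Aₖ
        ≈⟨ *-assoc d d Aₖ ⟩
      d * (d * Aₖ)
        ≈⟨ *-congˡ degGF ⟩
      d * (x * (𝟏 - y) * H + x * (𝟏 - κ * y) * Cₖ - x + (𝟏 - κ) * y)
        ≈⟨ *-congˡ (+-congʳ (+-congʳ (+-congʳ (*-congˡ headGF)))) ⟩
      d * (x * (𝟏 - y) * (x * Cₖ - y * G) + x * (𝟏 - κ * y) * Cₖ - x + (𝟏 - κ) * y)
        ≈⟨ solve 4 (λ x y κ Cₖ → let d = con (+ 1) :- con (+ 2) :* x :+ x :* y in
             d :* (x :* (con (+ 1) :- y) :* (x :* Cₖ :- y :* (con (+ 1) :+ x :* Cₖ))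
                   :+ x :* (con (+ 1) :- κ :* y) :* Cₖ :- x :+ (con (+ 1) :- κ) :* y)
             := (x :* (con (+ 1) :- y) :* (x :- x :* y) :+ x :* (con (+ 1) :- κ :* y)) :* (d :* Cₖ)
                :+ d :* (:- x :* (con (+ 1) :- y) :* y :- x :+ (con (+ 1) :- κ) :* y))
           ≈-refl x y κ Cₖ ⟩
      (x * (𝟏 - y) * (x - x * y) + x * (𝟏 - κ * y)) * (d * Cₖ) + d * (- x * (𝟏 - y) * y - x + (𝟏 - κ) * y)
        ≈⟨ +-congʳ (*-congˡ countGF) ⟩
      (x * (𝟏 - y) * (x - x * y) + x * (𝟏 - κ * y)) * (𝟏 - y) + d * (- x * (𝟏 - y) * y - x + (𝟏 - κ) * y)
        ≈⟨ solve 3 (λ x y κ → let d = con (+ 1) :- con (+ 2) :* x :+ x :* y in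
             (x :* (con (+ 1) :- y) :* (x :- x :* y) :+ x :* (con (+ 1) :- κ :* y)) :* (con (+ 1) :- y)
               :+ d :* (:- x :* (con (+ 1) :- y) :* y :- x :+ (con (+ 1) :- κ) :* y)
             := con (+ 3) :* x :^ 2 :+ ((con (+ 1) :- κ) :* y :+ (:- (con (+ 4) :- κ) :* (x :* y)
                :+ (con (ℤ.- + 2) :* (y :* x :^ 2) :+ con (+ 2) :* (x :* (y :* y))))))
           ≈-refl x y κ ⟩
      ⟦ + 3 ⟧ * x ^ 2 + ((𝟏 - κ) * y + (- (⟦ + 4 ⟧ - κ) * (x * y)
        + (⟦ ℤ.- + 2 ⟧ * (y * x ^ 2) + ⟦ + 2 ⟧ * (x * (y * y)))))
        ≈⟨ numerator≈ ⟨
      numerator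
        ∎

-- The generating function of deg₄

module Deg4Series (q : ℕ) where
  open Counting (suc q)
  open PowerSeries
  open CommutativeRing ring using (_≈_; _+_; _*_; _-_; +-cong; *-cong; setoid)
  open import Relation.Binary.Reasoning.Setoid setoid

  countSeries degreeSeries : ℕ → Series
  countSeries j n = + count j n
  degreeSeries j n = + degreeSum j n

  headSeries : Series
  headSeries n = + headOnes n

  count-one : countSeries 1 ≈ const (+ 1) + X * countSeries k
  count-one = ≗const⊕X⊛ (+ 1) (countSeries k) refl λ n →
    cong +_ (trans (Σadmissible-suc _ n (s≤s z≤n))
                   (trans (cong (count k n ℕ.+_) (Σadmissible-zero (λ _ → 1) n)) (ℕ.+-identityʳ (count k n))))

  count-suc : ∀ j → suc j < k → countSeries (suc (suc j)) ≈ const (+ 1) + X * (countSeries k + countSeries (suc j))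
  count-suc j j<k = ≗const⊕X⊛ (+ 1) _ refl λ n → cong +_ (Σadmissible-suc _ n j<k)

  degree-one : degreeSeries 1 ≈ X * (degreeSeries k + headSeries)
  degree-one = ≗X⊛ _ refl λ n →
    cong +_ (trans (degreeSum-suc n (s≤s z≤n))
                   (trans (cong₂ (λ s t → degreeSum k n ℕ.+ headOnes n ℕ.+ (s ℕ.+ t))
                                 (Σadmissible-zero deg4 n) (Σadmissible-zero (link true) n))
                          (ℕ.+-identityʳ _)))

  nonemptyCount≡ : ∀ {j} n → j < k → + nonemptyCount (suc j) n ≡ (countSeries (suc j) - const (+ 1)) n
  nonemptyCount≡ zero    j<k = refl
  nonemptyCount≡ (suc n) j<k = trans (cong +_ (nonemptyCount-suc n j<k)) (sym (ℤ.+-identityʳ _))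

  degree-suc : ∀ j → suc j < k →
    degreeSeries (suc (suc j))
      ≈ X * (degreeSeries k + headSeries + degreeSeries (suc j) + (countSeries (suc j) - const (+ 1)))
  degree-suc j j<k = ≗X⊛ _ refl λ n →
    trans (cong +_ (trans (degreeSum-suc n j<k) (sym (ℕ.+-assoc (degreeSum k n ℕ.+ headOnes n) _ _))))
          (cong (λ t → + (degreeSum k n ℕ.+ headOnes n ℕ.+ degreeSum (suc j) n) ℤ.+ t)
                (nonemptyCount≡ n (ℕ.<-trans (ℕ.n<1+n j) j<k)))

  headSeries≈ : headSeries ≈ X * countSeries (suc q)
  headSeries≈ = ≗X⊛ _ refl λ n → cong +_ (headOnes-suc n)

  genDeg4≈ : genDeg4 k ≈ degreeSeries k
  genDeg4≈ zero    = refl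
  genDeg4≈ (suc n) = cong +_ (sum-deg4-F (suc n))

  open Recurrences.Solution ring constMorphism q X headSeries countSeries degreeSeries
                   count-one count-suc degree-one degree-suc headSeries≈
    using (denominator; numerator; generatingFunction)

  denom≈ : denom k ≈ denominator
  denom≈ = +-cong (mono≗ (+ 1) 0) (+-cong (mono≗ (ℤ.- + 2) 1) (mono≗ (+ 1) (suc k)))

  numer≈ : numer k ≈ numerator
  numer≈ = +-cong (mono≗ (+ 3) 2) (+-cong (mono≗ (+ 1 ℤ.- + k) k) (+-cong (mono≗ (ℤ.- (+ 4 ℤ.- + k)) (suc k))
             (+-cong (mono≗ (ℤ.- + 2) (k ℕ.+ 2)) (mono≗ (+ 2) (suc (k ℕ.+ k))))))

  deg4GF : (denom k ⊛ denom k) ⊛ genDeg4 k ≈ numer k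
  deg4GF = begin
    (denom k ⊛ denom k) ⊛ genDeg4 k                ≈⟨ *-cong (*-cong denom≈ denom≈) genDeg4≈ ⟩
    denominator * denominator * degreeSeries k     ≈⟨ generatingFunction ⟩
    numerator                                      ≈⟨ numer≈ ⟨
    numer k                                        ∎

corollary3p4 : (k : ℕ) → 2 ≤ k →
    (m : ℕ) → ((denom k ⊛ denom k) ⊛ genDeg4 k) m ≡ numer k m
corollary3p4 (suc (suc q)) (s≤s (s≤s z≤n)) = Deg4Series.deg4GF q
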